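{- There exist $p, q \in \mathbb N_{>1}$, $m_i, n_i \in \mathbb N_{>1}$ for $i = 0,1,2,\ldots$, and positive rationals $a$ and $a_k$ for $k = 1,2,\ldots$, satisfying: (i) the map $(m,n) \mapsto p^m q^n$ is an injection of $\mathbb N_{>1}\times\mathbb N_{>1}$ into $\mathbb N_{>1}$; (ii) the pairs $(m_i,n_i)$, $i = 0,1,\ldots$, enumerate $\mathbb N_{>1}\times\mathbb N_{>1}$ (each pair occurring); (iii) $p^{m_0}q^{n_0} < p^{m_1}q^{n_1} < p^{m_2}q^{n_2} < \cdots$; (iv) for $i = 0,1,\ldots$: $a_{4i+1} = p^{ -m_i}q^{ -n_i}$, $a_{4i+2} = m_i p^{ -m_i}q^{ -n_i}$, $a_{4i+3} = m_i n_i p^{ -m_i}q^{ -n_i}$, $a_{4i+4} = n_i p^{ -m_i}q^{ -n_i}$; (v) the series $\sum_{k=1}^\infty a_k$ converges to $a$, and $a < 1$.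
   Context: $\mathbb N_{>1}$ denotes the set of natural numbers greater than $1$. -}

module Defs where

open import Data.Nat as ℕ using (ℕ; zero; suc)
open import Data.Integer using (+_)
open import Data.Rational using (ℚ; _/_; 0ℚ; _+_)

-- recip d = 1/d for d ≥ 1 (only ever applied to positive naturals; recip 0 = 0 is a dummy value)
recip : ℕ → ℚ
recip zero = 0ℚ
recip (suc d) = (+ 1) / suc d

-- partialSum a N = a 1 + a 2 + ... + a N  (terms indexed from 1; a 0 is ignored)
partialSum : (ℕ → ℚ) → ℕ → ℚ
partialSum a zero = 0ℚ
partialSum a (suc N) = partialSum a N + a (suc N)

-- Take p = 3 and q = 5.  Since 3 is a prime not dividing 5, (m, n) ↦ 3ᵐ5ⁿ is injective; its
-- image is a decidable and unbounded set of naturals, so listing it in increasing order by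
-- repeated least-element search enumerates all exponent pairs (mᵢ, nᵢ), m, n ≥ 2, with strictly
-- increasing 3^mᵢ5^nᵢ.  A block adds up to the weight (mᵢ + 1)/3^mᵢ · (nᵢ + 1)/5^nᵢ, so partial sums over
-- whole blocks are sums of weights over the first pairs.  The first pairs lie in a square
-- [2, M + 1]² and, conversely, fill any given square from some point on; the sum over a square
-- factorises into partial sums of Σ_{x ≥ 2} (x + 1)/bˣ for b = 3 and b = 5, whose tails have a
-- closed form.  Hence the partial sums increase to a = 7/12 · 13/80 < 1.
module Submission where

open import Defs

module Proof where

  open import Data.Nat as ℕ using (ℕ; zero; suc; _^_; z≤n; s≤s; NonZero)
  import Data.Nat.Properties as ℕP
  open import Data.Integer as ℤ using (+_)
  import Data.Integer.Properties as ℤP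
  open import Data.Rational as ℚ using (ℚ; mkℚ; 0ℚ; 1ℚ; _+_; _*_; _-_; _≤_; _<_; ∣_∣)
  import Data.Rational.Properties as ℚP
  import Data.Rational.Unnormalised as ℚᵘ
  import Data.Rational.Unnormalised.Properties as ℚᵘP
  open import Data.Product using (∃; _×_; _,_; proj₁; proj₂)
  open import Relation.Binary.PropositionalEquality
  open import Data.Nat.Tactic.RingSolver using (solve-∀)
  import Data.Rational.Solver
  open import Data.Sum using (inj₁; inj₂)
  open import Data.Empty using (⊥-elim)
  open import Data.Fin using (Fin; zero; suc; toℕ)
  open import Data.List using (List; []; _∷_; _++_; map; cartesianProduct; downFrom; applyDownFrom)
  open import Data.List.Membership.Propositional using (_∈_)
  open import Data.List.Membership.Propositional.Properties
    using (∈-∃++; ∈-++⁻; ∈-++⁺ˡ; ∈-++⁺ʳ; ∈-applyDownFrom⁺; ∈-applyDownFrom⁻; ∈-cartesianProduct⁺; ∈-cartesianProduct⁻)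
  open import Data.List.Relation.Unary.Any using (here; there)
  import Data.List.Relation.Unary.All as All
  open import Data.List.Relation.Unary.Unique.Propositional using (Unique; []; _∷_)
  open import Data.List.Relation.Unary.Unique.Propositional.Properties using (applyDownFrom⁺₁; cartesianProduct⁺)
  open import Relation.Nullary.Decidable using (from-yes; from-no; map′; _×-dec_)
  open import Relation.Nullary using (¬_; yes; no)
  open import Relation.Unary using (Decidable)
  open import Relation.Binary.Definitions using (tri<; tri≈; tri>)
  open import Induction.WellFounded using (Acc; acc)
  open import Data.Nat.Induction using (<-wellFounded)
  open import Data.Nat.Divisibility using (_∣_; _∣?_; divides; ∣1⇒≡1)
  open import Data.Nat.Primality using (Prime; prime?; euclidsLemma; prime⇒nonZero; prime⇒nonTrivial)

  module QS = Data.Rational.Solver.+-*-Solver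

  -- frac a d is the rational a/d, written exactly as in the statement: (a / 1) * recip d.
  frac : ℕ → ℕ → ℚ
  frac a d = (+ a ℚ./ 1) * recip d

  -- In the unnormalised rationals, where equality and order are cross-multiplication,
  -- frac a d is the plain fraction a/d.  Every fact about fractions below is read off here.
  toℚᵘ-frac : ∀ a d .{{_ : NonZero d}} → ℚ.toℚᵘ (frac a d) ℚᵘ.≃ (+ a ℚᵘ./ d)
  toℚᵘ-frac a (suc k) = ℚᵘP.≃-trans (ℚP.toℚᵘ-homo-* (+ a ℚ./ 1) (recip (suc k)))
    (ℚᵘP.≃-trans (ℚᵘP.*-cong (ℚP.toℚᵘ-fromℚᵘ (ℚᵘ.mkℚᵘ (+ a) 0)) (ℚP.toℚᵘ-fromℚᵘ (ℚᵘ.mkℚᵘ (+ 1) k)))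
      (ℚᵘ.*≡* (cong₂ ℤ._*_ (ℤP.*-identityʳ (+ a)) (cong (λ n → + suc n) (sym (ℕP.+-identityʳ k))))))

  frac-≡ : ∀ a d a′ d′ .{{_ : NonZero d}} .{{_ : NonZero d′}} →
           a ℕ.* d′ ≡ a′ ℕ.* d → frac a d ≡ frac a′ d′
  frac-≡ a d@(suc _) a′ d′@(suc _) eq = ℚP.toℚᵘ-injective (ℚᵘP.≃-trans (toℚᵘ-frac a d)
    (ℚᵘP.≃-trans (ℚᵘ.*≡* (trans (sym (ℤP.pos-* a d′)) (trans (cong +_ eq) (ℤP.pos-* a′ d))))
      (ℚᵘP.≃-sym (toℚᵘ-frac a′ d′))))

  frac-≤ : ∀ a d a′ d′ .{{_ : NonZero d}} .{{_ : NonZero d′}} →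
           a ℕ.* d′ ℕ.≤ a′ ℕ.* d → frac a d ≤ frac a′ d′
  frac-≤ a d@(suc _) a′ d′@(suc _) le = ℚP.toℚᵘ-cancel-≤ (ℚᵘP.≤-respˡ-≃ (ℚᵘP.≃-sym (toℚᵘ-frac a d))
    (ℚᵘP.≤-respʳ-≃ (ℚᵘP.≃-sym (toℚᵘ-frac a′ d′))
      (ℚᵘ.*≤* (subst₂ ℤ._≤_ (ℤP.pos-* a d′) (ℤP.pos-* a′ d) (ℤ.+≤+ le)))))

  frac-< : ∀ a d a′ d′ .{{_ : NonZero d}} .{{_ : NonZero d′}} →
           a ℕ.* d′ ℕ.< a′ ℕ.* d → frac a d < frac a′ d′
  frac-< a d@(suc _) a′ d′@(suc _) lt = ℚP.toℚᵘ-cancel-< (ℚᵘP.<-respˡ-≃ (ℚᵘP.≃-sym (toℚᵘ-frac a d))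
    (ℚᵘP.<-respʳ-≃ (ℚᵘP.≃-sym (toℚᵘ-frac a′ d′))
      (ℚᵘ.*<* (subst₂ ℤ._<_ (ℤP.pos-* a d′) (ℤP.pos-* a′ d) (ℤ.+<+ lt)))))

  frac-+ : ∀ a d a′ d′ .{{_ : NonZero d}} .{{_ : NonZero d′}} →
           frac a d + frac a′ d′ ≡ frac (a ℕ.* d′ ℕ.+ a′ ℕ.* d) (d ℕ.* d′)
  frac-+ a d@(suc _) a′ d′@(suc _) = ℚP.toℚᵘ-injective (ℚᵘP.≃-trans (ℚP.toℚᵘ-homo-+ (frac a d) (frac a′ d′))
    (ℚᵘP.≃-trans (ℚᵘP.+-cong (toℚᵘ-frac a d) (toℚᵘ-frac a′ d′))
      (ℚᵘP.≃-trans (ℚᵘP.≃-reflexive (cong (ℚᵘ._/ (d ℕ.* d′)) numerator))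
        (ℚᵘP.≃-sym (toℚᵘ-frac (a ℕ.* d′ ℕ.+ a′ ℕ.* d) (d ℕ.* d′))))))
    where
    numerator : + a ℤ.* + d′ ℤ.+ + a′ ℤ.* + d ≡ + (a ℕ.* d′ ℕ.+ a′ ℕ.* d)
    numerator = trans (sym (cong₂ ℤ._+_ (ℤP.pos-* a d′) (ℤP.pos-* a′ d))) (sym (ℤP.pos-+ (a ℕ.* d′) (a′ ℕ.* d)))

  frac-* : ∀ a d a′ d′ .{{_ : NonZero d}} .{{_ : NonZero d′}} →
           frac a d * frac a′ d′ ≡ frac (a ℕ.* a′) (d ℕ.* d′)
  frac-* a d@(suc _) a′ d′@(suc _) = ℚP.toℚᵘ-injective (ℚᵘP.≃-trans (ℚP.toℚᵘ-homo-* (frac a d) (frac a′ d′))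
    (ℚᵘP.≃-trans (ℚᵘP.*-cong (toℚᵘ-frac a d) (toℚᵘ-frac a′ d′))
      (ℚᵘP.≃-trans (ℚᵘP.≃-reflexive (cong (ℚᵘ._/ (d ℕ.* d′)) (sym (ℤP.pos-* a a′))))
        (ℚᵘP.≃-sym (toℚᵘ-frac (a ℕ.* a′) (d ℕ.* d′))))))

  recip≡frac1 : ∀ d → recip d ≡ frac 1 d
  recip≡frac1 d = sym (ℚP.*-identityˡ (recip d))

  frac≡/ : ∀ a d → frac a (suc d) ≡ + a ℚ./ suc d
  frac≡/ a d = ℚP.toℚᵘ-injective (ℚᵘP.≃-trans (toℚᵘ-frac a (suc d))
    (ℚᵘP.≃-sym (ℚP.toℚᵘ-fromℚᵘ (ℚᵘ.mkℚᵘ (+ a) d))))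

  -- Positivity and nonnegativity, comparing with 0ℚ, which is definitionally frac 0 1.
  frac-pos : ∀ a d .{{_ : NonZero d}} → 0 ℕ.< a → 0ℚ < frac a d
  frac-pos a d 0<a = frac-< 0 1 a d (subst (0 ℕ.<_) (sym (ℕP.*-identityʳ a)) 0<a)

  frac-nonNeg : ∀ a d .{{_ : NonZero d}} → 0ℚ ≤ frac a d
  frac-nonNeg a d = frac-≤ 0 1 a d z≤n

  frac-+-common : ∀ a a′ d .{{_ : NonZero d}} → frac a d + frac a′ d ≡ frac (a ℕ.+ a′) d
  frac-+-common a a′ d@(suc _) = trans (frac-+ a d a′ d) (frac-≡ (a ℕ.* d ℕ.+ a′ ℕ.* d) (d ℕ.* d) (a ℕ.+ a′) d (cross a a′ d))
    where
    cross : ∀ a a′ d → (a ℕ.* d ℕ.+ a′ ℕ.* d) ℕ.* d ≡ (a ℕ.+ a′) ℕ.* (d ℕ.* d)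
    cross = solve-∀

  halves : ∀ d → frac 1 (2 ℕ.* suc d) + frac 1 (2 ℕ.* suc d) ≡ frac 1 (suc d)
  halves d = trans (frac-+-common 1 1 (2 ℕ.* suc d)) (frac-≡ 2 (2 ℕ.* suc d) 1 (suc d) (sym (ℕP.*-identityˡ _)))

  unit-fraction-below : ∀ ε → 0ℚ < ε → ∃ λ d → frac 1 (suc d) ≤ ε
  unit-fraction-below ε@(mkℚ (+ suc n) d _) _ =
    d , subst (frac 1 (suc d) ≤_) (trans (frac≡/ (suc n) d) (ℚP.↥p/↧p≡p ε))
          (frac-≤ 1 (suc d) (suc n) (suc d) (ℕP.*-monoˡ-≤ (suc d) {1} {suc n} (s≤s z≤n)))
  unit-fraction-below (mkℚ (+ zero) _ _) (ℚ.*<* (ℤ.+<+ ()))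
  unit-fraction-below (mkℚ ℤ.-[1+ _ ] _ _) (ℚ.*<* ())

  close-from-below : ∀ {x a ε} → x ≤ a → a < x + ε → ∣ x - a ∣ < ε
  close-from-below {x} {a} {ε} x≤a a<x+ε = subst (_< ε) (sym ∣x-a∣≡a-x) a-x<ε
    where
    0≤a-x : 0ℚ ≤ a - x
    0≤a-x = subst (_≤ a - x) (ℚP.+-inverseʳ x) (ℚP.+-monoˡ-≤ (ℚ.- x) x≤a)
    ∣x-a∣≡a-x : ∣ x - a ∣ ≡ a - x
    ∣x-a∣≡a-x = begin
      ∣ x - a ∣         ≡⟨ cong ∣_∣ (QS.solve 2 (λ x a → x QS.:- a QS.:= QS.:- (a QS.:- x)) refl x a) ⟩
      ∣ ℚ.- (a - x) ∣   ≡⟨ ℚP.∣-p∣≡∣p∣ (a - x) ⟩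
      ∣ a - x ∣         ≡⟨ ℚP.0≤p⇒∣p∣≡p 0≤a-x ⟩
      a - x             ∎
      where open ≡-Reasoning
    a-x<ε : a - x < ε
    a-x<ε = subst (a - x <_) (QS.solve 2 (λ x ε → x QS.:+ ε QS.:- x QS.:= ε) refl x ε) (ℚP.+-monoˡ-< (ℚ.- x) a<x+ε)

  product-truncation : ∀ {g r h r′} → 0ℚ ≤ g → 0ℚ ≤ r → 0ℚ ≤ h → 0ℚ ≤ r′ →
                       g + r ≤ 1ℚ → h + r′ ≤ 1ℚ → (g + r) * (h + r′) ≤ g * h + (r + r′)
  product-truncation {g} {r} {h} {r′} 0≤g 0≤r 0≤h 0≤r′ g+r≤1 h+r′≤1 = begin
    (g + r) * (h + r′)              ≡⟨ QS.solve 4 (λ g r h r′ → (g QS.:+ r) QS.:* (h QS.:+ r′)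
                                          QS.:= g QS.:* h QS.:+ (g QS.:* r′ QS.:+ r QS.:* (h QS.:+ r′))) refl g r h r′ ⟩
    g * h + (g * r′ + r * (h + r′)) ≤⟨ ℚP.+-monoʳ-≤ (g * h) (ℚP.+-mono-≤ gr′≤r′ r[h+r′]≤r) ⟩
    g * h + (r′ + r)                ≡⟨ cong (_+_ (g * h)) (ℚP.+-comm r′ r) ⟩
    g * h + (r + r′)                ∎
    where
    open ℚP.≤-Reasoning
    g≤1 : g ≤ 1ℚ
    g≤1 = ℚP.≤-trans (subst (_≤ g + r) (ℚP.+-identityʳ g) (ℚP.+-monoʳ-≤ g 0≤r)) g+r≤1
    gr′≤r′ : g * r′ ≤ r′
    gr′≤r′ = subst (g * r′ ≤_) (ℚP.*-identityˡ r′) (ℚP.*-monoʳ-≤-nonNeg r′ {{ℚ.nonNegative 0≤r′}} g≤1)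
    r[h+r′]≤r : r * (h + r′) ≤ r
    r[h+r′]≤r = subst (r * (h + r′) ≤_) (ℚP.*-identityʳ r) (ℚP.*-monoˡ-≤-nonNeg r {{ℚ.nonNegative 0≤r}} h+r′≤1)

  *-mono-≤-nonNeg : ∀ {g G h H} → 0ℚ ≤ g → 0ℚ ≤ h → g ≤ G → h ≤ H → g * h ≤ G * H
  *-mono-≤-nonNeg {g} {G} {h} {H} 0≤g 0≤h g≤G h≤H = ℚP.≤-trans
    (ℚP.*-monoʳ-≤-nonNeg h {{ℚ.nonNegative 0≤h}} g≤G)
    (ℚP.*-monoˡ-≤-nonNeg G {{ℚ.nonNegative (ℚP.≤-trans 0≤g g≤G)}} h≤H)

  sumL : {A : Set} → (A → ℚ) → List A → ℚ
  sumL f []       = 0ℚ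
  sumL f (x ∷ xs) = f x + sumL f xs

  module _ {A : Set} (f : A → ℚ) where

    sumL-nonNeg : (∀ x → 0ℚ ≤ f x) → ∀ xs → 0ℚ ≤ sumL f xs
    sumL-nonNeg f≥0 []       = ℚP.≤-refl
    sumL-nonNeg f≥0 (x ∷ xs) = ℚP.+-mono-≤ (f≥0 x) (sumL-nonNeg f≥0 xs)

    sumL-++ : ∀ xs ys → sumL f (xs ++ ys) ≡ sumL f xs + sumL f ys
    sumL-++ []       ys = sym (ℚP.+-identityˡ (sumL f ys))
    sumL-++ (x ∷ xs) ys = trans (cong (_+_ (f x)) (sumL-++ xs ys)) (sym (ℚP.+-assoc (f x) (sumL f xs) (sumL f ys)))

    sumL-⊆ : (∀ x → 0ℚ ≤ f x) → ∀ {xs} ys → Unique xs → (∀ {x} → x ∈ xs → x ∈ ys) → sumL f xs ≤ sumL f ys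
    sumL-⊆ f≥0 {[]}     ys _              _    = sumL-nonNeg f≥0 ys
    sumL-⊆ f≥0 {x ∷ xs} ys (x∉xs ∷ uniq) xs⊆ys with ∈-∃++ (xs⊆ys (here refl))
    ... | us , vs , refl = subst (sumL f (x ∷ xs) ≤_) (sym split)
                             (ℚP.+-monoʳ-≤ (f x) (sumL-⊆ f≥0 (us ++ vs) uniq xs⊆us++vs))
      where
      xs⊆us++vs : ∀ {z} → z ∈ xs → z ∈ us ++ vs
      xs⊆us++vs z∈xs with ∈-++⁻ us (xs⊆ys (there z∈xs))
      ... | inj₁ z∈us          = ∈-++⁺ˡ z∈us
      ... | inj₂ (here refl)   = ⊥-elim (All.lookup x∉xs z∈xs refl)
      ... | inj₂ (there z∈vs)  = ∈-++⁺ʳ us z∈vs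
      split : sumL f (us ++ x ∷ vs) ≡ f x + sumL f (us ++ vs)
      split = begin
        sumL f (us ++ x ∷ vs)              ≡⟨ sumL-++ us (x ∷ vs) ⟩
        sumL f us + (f x + sumL f vs)      ≡⟨ QS.solve 3 (λ u a v → u QS.:+ (a QS.:+ v) QS.:= a QS.:+ (u QS.:+ v)) refl (sumL f us) (f x) (sumL f vs) ⟩
        f x + (sumL f us + sumL f vs)      ≡⟨ cong (_+_ (f x)) (sym (sumL-++ us vs)) ⟩
        f x + sumL f (us ++ vs)            ∎
        where open ≡-Reasoning

  sumL-cartesianProduct : ∀ {A B : Set} (g : A → ℚ) (h : B → ℚ) xs ys →
    sumL (λ (z : A × B) → g (proj₁ z) * h (proj₂ z)) (cartesianProduct xs ys) ≡ sumL g xs * sumL h ys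
  sumL-cartesianProduct g h []       ys = sym (ℚP.*-zeroˡ (sumL h ys))
  sumL-cartesianProduct g h (x ∷ xs) ys = begin
    sumL F (map (x ,_) ys ++ cartesianProduct xs ys)         ≡⟨ sumL-++ F (map (x ,_) ys) _ ⟩
    sumL F (map (x ,_) ys) + sumL F (cartesianProduct xs ys) ≡⟨ cong₂ _+_ (row ys) (sumL-cartesianProduct g h xs ys) ⟩
    g x * sumL h ys + sumL g xs * sumL h ys                   ≡⟨ sym (ℚP.*-distribʳ-+ (sumL h ys) (g x) (sumL g xs)) ⟩
    (g x + sumL g xs) * sumL h ys                             ∎
    where
    open ≡-Reasoning
    F = λ (z : _ × _) → g (proj₁ z) * h (proj₂ z)
    row : ∀ ys → sumL F (map (x ,_) ys) ≡ g x * sumL h ys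
    row []       = sym (ℚP.*-zeroʳ (g x))
    row (y ∷ ys) = trans (cong (_+_ (F (x , y))) (row ys)) (sym (ℚP.*-distribˡ-+ (g x) (h y) (sumL h ys)))

  partialSum-mono : ∀ (a : ℕ → ℚ) → (∀ k → 0ℚ ≤ a (suc k)) → ∀ {K K′} → K ℕ.≤ K′ → partialSum a K ≤ partialSum a K′
  partialSum-mono a a≥0 {K} {K′} K≤K′ with ℕP.m≤n⇒∃[o]m+o≡n K≤K′
  ... | o , refl = extend o
    where
    extend : ∀ o → partialSum a K ≤ partialSum a (K ℕ.+ o)
    extend zero    = ℚP.≤-reflexive (cong (partialSum a) (sym (ℕP.+-identityʳ K)))
    extend (suc o) = ℚP.≤-trans (extend o)
      (subst₂ _≤_ (ℚP.+-identityʳ _) (cong (partialSum a) (sym (ℕP.+-suc K o)))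
        (ℚP.+-monoʳ-≤ (partialSum a (K ℕ.+ o)) (a≥0 (K ℕ.+ o))))

  -- Laying out a family f r i (r < 4, i ∈ ℕ) as one sequence, block by block:
  -- blocks f (r + 4 i) = f r i.
  blocks : {A : Set} → (Fin 4 → ℕ → A) → ℕ → A
  blocks f 0 = f zero 0
  blocks f 1 = f (suc zero) 0
  blocks f 2 = f (suc (suc zero)) 0
  blocks f 3 = f (suc (suc (suc zero))) 0
  blocks f (suc (suc (suc (suc k)))) = blocks (λ r i → f r (suc i)) k

  module _ {A : Set} where

    blocks-shift : ∀ (f : Fin 4 → ℕ → A) i k → blocks f (k ℕ.+ 4 ℕ.* i) ≡ blocks (λ r j → f r (i ℕ.+ j)) k
    blocks-shift f zero    k = cong (blocks f) (ℕP.+-identityʳ k)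
    blocks-shift f (suc i) k = trans (cong (blocks f) (skip k i)) (blocks-shift (λ r j → f r (suc j)) i k)
      where
      skip : ∀ k i → k ℕ.+ 4 ℕ.* suc i ≡ 4 ℕ.+ (k ℕ.+ 4 ℕ.* i)
      skip = solve-∀

    blocks-at : ∀ (f : Fin 4 → ℕ → A) i r → blocks f (toℕ r ℕ.+ 4 ℕ.* i) ≡ f r i
    blocks-at f i r = trans (blocks-shift f i (toℕ r)) (trans (first-block r) (cong (f r) (ℕP.+-identityʳ i)))
      where
      first-block : ∀ r → blocks (λ r j → f r (i ℕ.+ j)) (toℕ r) ≡ f r (i ℕ.+ 0)
      first-block zero                   = refl
      first-block (suc zero)             = refl
      first-block (suc (suc zero))       = refl
      first-block (suc (suc (suc zero))) = refl

    blocks-all : ∀ (P : A → Set) (f : Fin 4 → ℕ → A) → (∀ r i → P (f r i)) → ∀ k → P (blocks f k)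
    blocks-all P f Pf 0 = Pf zero 0
    blocks-all P f Pf 1 = Pf (suc zero) 0
    blocks-all P f Pf 2 = Pf (suc (suc zero)) 0
    blocks-all P f Pf 3 = Pf (suc (suc (suc zero))) 0
    blocks-all P f Pf (suc (suc (suc (suc k)))) = blocks-all P (λ r i → f r (suc i)) (λ r i → Pf r (suc i)) k

  blockSeries : (Fin 4 → ℕ → ℚ) → ℕ → ℚ
  blockSeries f zero    = 0ℚ
  blockSeries f (suc k) = blocks f k

  blockTotal : (Fin 4 → ℕ → ℚ) → ℕ → ℚ
  blockTotal f i = ((f zero i + f (suc zero) i) + f (suc (suc zero)) i) + f (suc (suc (suc zero))) i

  partialSum-blocks : ∀ f j → partialSum (blockSeries f) (4 ℕ.* j) ≡ sumL (blockTotal f) (downFrom j)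
  partialSum-blocks f zero    = refl
  partialSum-blocks f (suc j) = begin
    partialSum (blockSeries f) (4 ℕ.* suc j)
      ≡⟨ cong (partialSum (blockSeries f)) (ℕP.*-suc 4 j) ⟩
    (((S + blocks f (4 ℕ.* j)) + blocks f (1 ℕ.+ 4 ℕ.* j)) + blocks f (2 ℕ.+ 4 ℕ.* j)) + blocks f (3 ℕ.+ 4 ℕ.* j)
      ≡⟨ cong₂ _+_ (cong₂ _+_ (cong₂ _+_ (cong (_+_ S) (blocks-at f j zero)) (blocks-at f j (suc zero)))
                                        (blocks-at f j (suc (suc zero)))) (blocks-at f j (suc (suc (suc zero)))) ⟩
    (((S + f zero j) + f (suc zero) j) + f (suc (suc zero)) j) + f (suc (suc (suc zero))) j
      ≡⟨ QS.solve 5 (λ s a b c d → (((s QS.:+ a) QS.:+ b) QS.:+ c) QS.:+ d QS.:= (((a QS.:+ b) QS.:+ c) QS.:+ d) QS.:+ s)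
           refl S (f zero j) (f (suc zero) j) (f (suc (suc zero)) j) (f (suc (suc (suc zero))) j) ⟩
    blockTotal f j + S
      ≡⟨ cong (_+_ (blockTotal f j)) (partialSum-blocks f j) ⟩
    sumL (blockTotal f) (downFrom (suc j)) ∎
    where
    open ≡-Reasoning
    S = partialSum (blockSeries f) (4 ℕ.* j)

  -- The coordinates 2, 3, …, M + 1.
  range : ℕ → List ℕ
  range = applyDownFrom (2 ℕ.+_)

  ∈-range⁺ : ∀ {x M} → 2 ℕ.≤ x → x ℕ.< 2 ℕ.+ M → x ∈ range M
  ∈-range⁺ {suc (suc i)} (s≤s (s≤s _)) (s≤s (s≤s i<M)) = ∈-applyDownFrom⁺ (2 ℕ.+_) i<M

  ∈-range⁻ : ∀ {x M} → x ∈ range M → 2 ℕ.≤ x × x ℕ.< 2 ℕ.+ M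
  ∈-range⁻ x∈ with ∈-applyDownFrom⁻ (2 ℕ.+_) x∈
  ... | i , i<M , refl = s≤s (s≤s z≤n) , s≤s (s≤s i<M)

  range-unique : ∀ M → Unique (range M)
  range-unique M = applyDownFrom⁺₁ (2 ℕ.+_) M (λ j<i _ eq → ℕP.<⇒≢ j<i (sym (ℕP.+-cancelˡ-≡ 2 _ _ eq)))

  tail-numerator-≤ : ∀ c M .{{_ : NonZero c}} → c ℕ.* M ℕ.+ 3 ℕ.* c ℕ.+ 1 ℕ.≤ c ℕ.* c ℕ.* (M ℕ.+ 4)
  tail-numerator-≤ (suc k) M = subst (suc k ℕ.* M ℕ.+ 3 ℕ.* suc k ℕ.+ 1 ℕ.≤_) (sym (expand k M)) (ℕP.m≤m+n _ _)
    where
    expand : ∀ k M → suc k ℕ.* suc k ℕ.* (M ℕ.+ 4)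
                   ≡ (suc k ℕ.* M ℕ.+ 3 ℕ.* suc k ℕ.+ 1) ℕ.+ (k ℕ.+ k ℕ.* suc k ℕ.* (M ℕ.+ 4))
    expand = solve-∀

  -- The horizon beyond which (M + 4)/2^(M+1) drops below 1/(2(d+1)).
  horizon : ℕ → ℕ
  horizon zero    = 3
  horizon (suc d) = 2 ℕ.+ horizon d

  horizon-growth : ∀ d → (horizon d ℕ.+ 4) ℕ.* (2 ℕ.* suc d) ℕ.< 1 ℕ.* 2 ^ suc (horizon d)
  horizon-growth zero    = from-yes (14 ℕP.<? 16)
  horizon-growth (suc d) = begin-strict
    (2 ℕ.+ h ℕ.+ 4) ℕ.* (2 ℕ.* suc (suc d))      ≤⟨ ℕP.m≤m+n _ _ ⟩
    (2 ℕ.+ h ℕ.+ 4) ℕ.* (2 ℕ.* suc (suc d)) ℕ.+ (6 ℕ.* h ℕ.* d ℕ.+ 4 ℕ.* h ℕ.+ 20 ℕ.* d ℕ.+ 8)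
                                                   ≡⟨ quadruple h d ⟩
    4 ℕ.* ((h ℕ.+ 4) ℕ.* (2 ℕ.* suc d))          <⟨ ℕP.*-monoʳ-< 4 (horizon-growth d) ⟩
    4 ℕ.* (1 ℕ.* 2 ^ suc h)                       ≡⟨ double-twice (2 ^ suc h) ⟩
    1 ℕ.* 2 ^ suc (2 ℕ.+ h)                       ∎
    where
    open ℕP.≤-Reasoning
    h = horizon d
    double-twice : ∀ x → 4 ℕ.* (1 ℕ.* x) ≡ 1 ℕ.* (2 ℕ.* (2 ℕ.* x))
    double-twice = solve-∀
    quadruple : ∀ h d → (2 ℕ.+ h ℕ.+ 4) ℕ.* (2 ℕ.* suc (suc d)) ℕ.+ (6 ℕ.* h ℕ.* d ℕ.+ 4 ℕ.* h ℕ.+ 20 ℕ.* d ℕ.+ 8)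
                        ≡ 4 ℕ.* ((h ℕ.+ 4) ℕ.* (2 ℕ.* suc d))
    quadruple = solve-∀

  -- The arithmetico-geometric series Σ_{m ≥ 2} (m + 1)/bᵐ for a base b = c + 1 ≥ 2.  Its tail
  -- beyond M + 1 has the closed form (cM + 3c + 1)/(c² b^(M+1)), so the partial sums are the
  -- total minus an explicit tail which is eventually small.
  module ArithmeticoGeometric (c : ℕ) .{{_ : NonZero c}} where

    b : ℕ
    b = suc c

    b^≢0 : ∀ m → NonZero (b ^ m)
    b^≢0 m = ℕP.m^n≢0 b m

    c²b^≢0 : ∀ m → NonZero (c ℕ.* c ℕ.* b ^ m)
    c²b^≢0 m = ℕP.m*n≢0 (c ℕ.* c) (b ^ m) {{ℕP.m*n≢0 c c}} {{b^≢0 m}}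

    term : ℕ → ℚ
    term m = frac (suc m) (b ^ m)

    partial : ℕ → ℚ
    partial M = sumL term (range M)

    -- Σ_{m ≥ M+2} (m + 1)/bᵐ, in closed form
    tail : ℕ → ℚ
    tail M = frac (c ℕ.* M ℕ.+ 3 ℕ.* c ℕ.+ 1) (c ℕ.* c ℕ.* b ^ suc M)

    -- Σ_{m ≥ 2} (m + 1)/bᵐ = (3c + 1)/(c² b)
    total : ℚ
    total = tail 0

    term-pos : ∀ m → 0ℚ < term m
    term-pos m = frac-pos (suc m) (b ^ m) {{b^≢0 m}} (s≤s z≤n)

    partial-nonNeg : ∀ M → 0ℚ ≤ partial M
    partial-nonNeg M = sumL-nonNeg term (λ m → ℚP.<⇒≤ (term-pos m)) (range M)

    tail-nonNeg : ∀ M → 0ℚ ≤ tail M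
    tail-nonNeg M = frac-nonNeg (c ℕ.* M ℕ.+ 3 ℕ.* c ℕ.+ 1) (c ℕ.* c ℕ.* b ^ suc M) {{c²b^≢0 (suc M)}}

    term+tail : ∀ M → term (2 ℕ.+ M) + tail (suc M) ≡ tail M
    term+tail M = begin
      frac (3 ℕ.+ M) B₂ + frac (c ℕ.* suc M ℕ.+ 3 ℕ.* c ℕ.+ 1) (c ℕ.* c ℕ.* B₂)
        ≡⟨ frac-+ (3 ℕ.+ M) B₂ (c ℕ.* suc M ℕ.+ 3 ℕ.* c ℕ.+ 1) (c ℕ.* c ℕ.* B₂) {{b^≢0 (2 ℕ.+ M)}} {{c²b^≢0 (2 ℕ.+ M)}} ⟩
      frac numerator (B₂ ℕ.* (c ℕ.* c ℕ.* B₂))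
        ≡⟨ frac-≡ numerator (B₂ ℕ.* (c ℕ.* c ℕ.* B₂)) (c ℕ.* M ℕ.+ 3 ℕ.* c ℕ.+ 1) (c ℕ.* c ℕ.* b ^ suc M)
                  {{ℕP.m*n≢0 B₂ _ {{b^≢0 (2 ℕ.+ M)}} {{c²b^≢0 (2 ℕ.+ M)}}}} {{c²b^≢0 (suc M)}}
                  (cross-multiplied c M (b ^ M)) ⟩
      frac (c ℕ.* M ℕ.+ 3 ℕ.* c ℕ.+ 1) (c ℕ.* c ℕ.* b ^ suc M) ∎
      where
      open ≡-Reasoning
      B₂ = b ^ (2 ℕ.+ M)
      numerator = (3 ℕ.+ M) ℕ.* (c ℕ.* c ℕ.* B₂) ℕ.+ (c ℕ.* suc M ℕ.+ 3 ℕ.* c ℕ.+ 1) ℕ.* B₂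
      cross-multiplied : ∀ c M x →
        ((3 ℕ.+ M) ℕ.* (c ℕ.* c ℕ.* (suc c ℕ.* (suc c ℕ.* x))) ℕ.+ (c ℕ.* suc M ℕ.+ 3 ℕ.* c ℕ.+ 1) ℕ.* (suc c ℕ.* (suc c ℕ.* x)))
          ℕ.* (c ℕ.* c ℕ.* (suc c ℕ.* x))
        ≡ (c ℕ.* M ℕ.+ 3 ℕ.* c ℕ.+ 1) ℕ.* (suc c ℕ.* (suc c ℕ.* x) ℕ.* (c ℕ.* c ℕ.* (suc c ℕ.* (suc c ℕ.* x))))
      cross-multiplied = solve-∀

    partial+tail : ∀ M → partial M + tail M ≡ total
    partial+tail zero    = ℚP.+-identityˡ total
    partial+tail (suc M) = begin
      (term (2 ℕ.+ M) + partial M) + tail (suc M) ≡⟨ QS.solve 3 (λ t p r → (t QS.:+ p) QS.:+ r QS.:= p QS.:+ (t QS.:+ r)) refl (term (2 ℕ.+ M)) (partial M) (tail (suc M)) ⟩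
      partial M + (term (2 ℕ.+ M) + tail (suc M)) ≡⟨ cong (_+_ (partial M)) (term+tail M) ⟩
      partial M + tail M                          ≡⟨ partial+tail M ⟩
      total                                       ∎
      where open ≡-Reasoning

    partial≤total : ∀ M → partial M ≤ total
    partial≤total M = subst (partial M ≤_) (partial+tail M)
      (subst (_≤ partial M + tail M) (ℚP.+-identityʳ (partial M)) (ℚP.+-monoʳ-≤ (partial M) (tail-nonNeg M)))

    tail≤base2 : ∀ M → tail M ≤ frac (M ℕ.+ 4) (2 ^ suc M)
    tail≤base2 M = frac-≤ (c ℕ.* M ℕ.+ 3 ℕ.* c ℕ.+ 1) (c ℕ.* c ℕ.* b ^ suc M) (M ℕ.+ 4) (2 ^ suc M)
                          {{c²b^≢0 (suc M)}} {{ℕP.m^n≢0 2 (suc M)}} (begin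
      (c ℕ.* M ℕ.+ 3 ℕ.* c ℕ.+ 1) ℕ.* 2 ^ suc M   ≤⟨ ℕP.*-mono-≤ (tail-numerator-≤ c M) (ℕP.^-monoˡ-≤ (suc M) (s≤s (ℕ.>-nonZero⁻¹ c))) ⟩
      c ℕ.* c ℕ.* (M ℕ.+ 4) ℕ.* b ^ suc M        ≡⟨ rearrange (c ℕ.* c) (M ℕ.+ 4) (b ^ suc M) ⟩
      (M ℕ.+ 4) ℕ.* (c ℕ.* c ℕ.* b ^ suc M)      ∎)
      where
      open ℕP.≤-Reasoning
      rearrange : ∀ x y z → x ℕ.* y ℕ.* z ≡ y ℕ.* (x ℕ.* z)
      rearrange = solve-∀

    tail-small : ∀ d → tail (horizon d) < frac 1 (2 ℕ.* suc d)
    tail-small d = ℚP.≤-<-trans (tail≤base2 (horizon d))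
      (frac-< (horizon d ℕ.+ 4) (2 ^ suc (horizon d)) 1 (2 ℕ.* suc d) {{ℕP.m^n≢0 2 (suc (horizon d))}} (horizon-growth d))

  least : ∀ {P : ℕ → Set} → Decidable P → ∀ {w} → P w → ∃ λ r → P r × (∀ {k} → k ℕ.< r → ¬ P k)
  least {P} P? {w} Pw = search w Pw (<-wellFounded w)
    where
    search : ∀ w → P w → Acc ℕ._<_ w → ∃ λ r → P r × (∀ {k} → k ℕ.< r → ¬ P k)
    search w Pw (acc smaller) with ℕP.anyUpTo? P? w
    ... | yes (k , k<w , Pk) = search k Pk (smaller k<w)
    ... | no none            = w , Pw , λ k<w Pk → none (_ , k<w , Pk)

  module Enumeration {P : ℕ → Set} (P? : Decidable P) (unbounded : ∀ lo → ∃ λ w → lo ℕ.≤ w × P w) where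

    private
      leastFrom : ∀ lo → ∃ λ r → (lo ℕ.≤ r × P r) × (∀ {k} → k ℕ.< r → ¬ (lo ℕ.≤ k × P k))
      leastFrom lo = least (λ k → lo ℕ.≤? k ×-dec P? k) (proj₂ (unbounded lo))

    next : ℕ → ℕ
    next lo = proj₁ (leastFrom lo)

    next-≥ : ∀ lo → lo ℕ.≤ next lo
    next-≥ lo = proj₁ (proj₁ (proj₂ (leastFrom lo)))

    next-∈ : ∀ lo → P (next lo)
    next-∈ lo = proj₂ (proj₁ (proj₂ (leastFrom lo)))

    next-least : ∀ lo {k} → lo ℕ.≤ k → P k → next lo ℕ.≤ k
    next-least lo lo≤k Pk = ℕP.≮⇒≥ (λ k<next → proj₂ (proj₂ (leastFrom lo)) k<next (lo≤k , Pk))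

    enum : ℕ → ℕ
    enum zero    = next 0
    enum (suc i) = next (suc (enum i))

    enum-∈ : ∀ i → P (enum i)
    enum-∈ zero    = next-∈ 0
    enum-∈ (suc i) = next-∈ (suc (enum i))

    enum-step : ∀ i → enum i ℕ.< enum (suc i)
    enum-step i = next-≥ (suc (enum i))

    enum-mono : ∀ {i j} → i ℕ.< j → enum i ℕ.< enum j
    enum-mono {i} {suc j} (s≤s i≤j) with ℕP.m≤n⇒m<n∨m≡n i≤j
    ... | inj₁ i<j  = ℕP.<-trans (enum-mono i<j) (enum-step j)
    ... | inj₂ refl = enum-step i

    index≤enum : ∀ i → i ℕ.≤ enum i
    index≤enum zero    = z≤n
    index≤enum (suc i) = ℕP.≤-<-trans (index≤enum i) (enum-step i)

    -- Every element of P is listed; an element s already appears among the first i + 1 entries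
    -- once s ≤ enum i.
    enum-onto : ∀ {s} → P s → ∃ λ i → enum i ≡ s
    enum-onto {s} Ps = below s (index≤enum s)
      where
      below : ∀ i → s ℕ.≤ enum i → ∃ λ j → enum j ≡ s
      below zero    s≤e = zero , ℕP.≤-antisym (next-least 0 z≤n Ps) s≤e
      below (suc i) s≤e with s ℕ.≤? enum i
      ... | yes s≤ei = below i s≤ei
      ... | no  s≰ei = suc i , ℕP.≤-antisym (next-least (suc (enum i)) (ℕP.≰⇒> s≰ei) Ps) s≤e

  n<b^n : ∀ {b} → 1 ℕ.< b → ∀ n → n ℕ.< b ^ n
  n<b^n 1<b zero    = s≤s z≤n
  n<b^n 1<b (suc n) = ℕP.<-≤-trans (s≤s (n<b^n 1<b n)) (ℕP.^-monoʳ-< _ 1<b (ℕP.n<1+n n))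

  ^-injectiveʳ : ∀ {b} → 1 ℕ.< b → ∀ {y y′} → b ^ y ≡ b ^ y′ → y ≡ y′
  ^-injectiveʳ {b} 1<b {y} {y′} eq with ℕP.<-cmp y y′
  ... | tri< y<y′ _ _ = ⊥-elim (ℕP.<-irrefl eq (ℕP.^-monoʳ-< b 1<b y<y′))
  ... | tri≈ _ y≡y′ _ = y≡y′
  ... | tri> _ _ y′<y = ⊥-elim (ℕP.<-irrefl (sym eq) (ℕP.^-monoʳ-< b 1<b y′<y))

  module PrimePowers {p q : ℕ} (p-prime : Prime p) (p∤q : ¬ p ∣ q) (1<q : 1 ℕ.< q) where

    p∤q^ : ∀ y → ¬ p ∣ q ^ y
    p∤q^ zero    p∣1 = ℕP.<-irrefl (sym (∣1⇒≡1 p∣1)) (ℕ.nonTrivial⇒n>1 p {{prime⇒nonTrivial p-prime}})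
    p∤q^ (suc y) p∣q^suc with euclidsLemma q (q ^ y) p-prime p∣q^suc
    ... | inj₁ p∣q   = p∤q p∣q
    ... | inj₂ p∣q^y = p∤q^ y p∣q^y

    private
      shuffle : ∀ p a b → p ℕ.* a ℕ.* b ≡ a ℕ.* b ℕ.* p
      shuffle = solve-∀

    factorisation-unique : ∀ x y x′ y′ → p ^ x ℕ.* q ^ y ≡ p ^ x′ ℕ.* q ^ y′ → x ≡ x′ × y ≡ y′
    factorisation-unique zero y zero y′ eq =
      refl , ^-injectiveʳ 1<q (trans (sym (ℕP.+-identityʳ (q ^ y))) (trans eq (ℕP.+-identityʳ (q ^ y′))))
    factorisation-unique zero y (suc x′) y′ eq =
      ⊥-elim (p∤q^ y (divides (p ^ x′ ℕ.* q ^ y′) (trans (sym (ℕP.+-identityʳ (q ^ y))) (trans eq (shuffle p (p ^ x′) (q ^ y′))))))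
    factorisation-unique (suc x) y zero y′ eq =
      ⊥-elim (p∤q^ y′ (divides (p ^ x ℕ.* q ^ y) (trans (sym (ℕP.+-identityʳ (q ^ y′))) (trans (sym eq) (shuffle p (p ^ x) (q ^ y))))))
    factorisation-unique (suc x) y (suc x′) y′ eq
      with factorisation-unique x y x′ y′ (ℕP.*-cancelˡ-≡ _ _ p {{prime⇒nonZero p-prime}}
             (trans (sym (ℕP.*-assoc p (p ^ x) (q ^ y))) (trans eq (ℕP.*-assoc p (p ^ x′) (q ^ y′)))))
    ... | refl , y≡y′ = refl , y≡y′

  value : ℕ → ℕ → ℕ
  value x y = 3 ^ x ℕ.* 5 ^ y

  value≢0 : ∀ x y → NonZero (value x y)
  value≢0 x y = ℕP.m*n≢0 (3 ^ x) (5 ^ y) {{ℕP.m^n≢0 3 x}} {{ℕP.m^n≢0 5 y}}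

  value-mono : ∀ {x x′ y y′} → x ℕ.≤ x′ → y ℕ.≤ y′ → value x y ℕ.≤ value x′ y′
  value-mono x≤x′ y≤y′ = ℕP.*-mono-≤ (ℕP.^-monoʳ-≤ 3 x≤x′) (ℕP.^-monoʳ-≤ 5 y≤y′)

  -- Both exponents are smaller than the value, so membership in the lattice is a bounded search.
  x<value : ∀ x y → x ℕ.< value x y
  x<value x y = ℕP.<-≤-trans (n<b^n (s≤s (s≤s z≤n)) x) (ℕP.m≤m*n (3 ^ x) (5 ^ y) {{ℕP.m^n≢0 5 y}})

  y<value : ∀ x y → y ℕ.< value x y
  y<value x y = ℕP.<-≤-trans (n<b^n (s≤s (s≤s z≤n)) y) (ℕP.m≤n*m (5 ^ y) (3 ^ x) {{ℕP.m^n≢0 3 x}})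

  Lattice : ℕ → Set
  Lattice v = ∃ λ x → ∃ λ y → 2 ℕ.≤ x × 2 ℕ.≤ y × value x y ≡ v

  lattice? : Decidable Lattice
  lattice? v = map′ unbound bound (ℕP.anyUpTo? (λ x → ℕP.anyUpTo? (λ y → 2 ℕ.≤? x ×-dec 2 ℕ.≤? y ×-dec value x y ℕ.≟ v) (suc v)) (suc v))
    where
    unbound : (∃ λ x → x ℕ.< suc v × ∃ λ y → y ℕ.< suc v × 2 ℕ.≤ x × 2 ℕ.≤ y × value x y ≡ v) → Lattice v
    unbound (x , _ , y , _ , in-lattice) = x , y , in-lattice
    bound : Lattice v → ∃ λ x → x ℕ.< suc v × ∃ λ y → y ℕ.< suc v × 2 ℕ.≤ x × 2 ℕ.≤ y × value x y ≡ v
    bound (x , y , 2≤x , 2≤y , refl) = x , s≤s (ℕP.<⇒≤ (x<value x y)) , y , s≤s (ℕP.<⇒≤ (y<value x y)) , 2≤x , 2≤y , refl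

  lattice-unbounded : ∀ lo → ∃ λ w → lo ℕ.≤ w × Lattice w
  lattice-unbounded lo = value (2 ℕ.+ lo) 2
    , ℕP.<⇒≤ (ℕP.≤-<-trans (ℕP.m≤n+m lo 2) (x<value (2 ℕ.+ lo) 2))
    , 2 ℕ.+ lo , 2 , s≤s (s≤s z≤n) , ℕP.≤-refl , refl

  open Enumeration lattice? lattice-unbounded
  open PrimePowers {3} {5} (from-yes (prime? 3)) (from-no (3 ∣? 5)) (s≤s (s≤s z≤n))

  value-injective : ∀ x y x′ y′ → value x y ≡ value x′ y′ → x ≡ x′ × y ≡ y′
  value-injective = factorisation-unique

  -- The i-th pair (m i , n i) is the exponent pair of the i-th smallest element of the lattice.
  m n : ℕ → ℕ
  m i = proj₁ (enum-∈ i)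
  n i = proj₁ (proj₂ (enum-∈ i))

  m≥2 : ∀ i → 2 ℕ.≤ m i
  m≥2 i = proj₁ (proj₂ (proj₂ (enum-∈ i)))

  n≥2 : ∀ i → 2 ℕ.≤ n i
  n≥2 i = proj₁ (proj₂ (proj₂ (proj₂ (enum-∈ i))))

  value-mn : ∀ i → value (m i) (n i) ≡ enum i
  value-mn i = proj₂ (proj₂ (proj₂ (proj₂ (enum-∈ i))))

  pair : ℕ → ℕ × ℕ
  pair i = m i , n i

  pair-index : ∀ x y → 2 ℕ.≤ x → 2 ℕ.≤ y → ∃ λ i → (m i ≡ x × n i ≡ y) × i ℕ.≤ value x y
  pair-index x y 2≤x 2≤y with enum-onto (x , y , 2≤x , 2≤y , refl)
  ... | i , enum-i = i , value-injective (m i) (n i) x y (trans (value-mn i) enum-i)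
                       , subst (i ℕ.≤_) enum-i (index≤enum i)

  same-pair⇒same-value : ∀ i j → pair i ≡ pair j → enum i ≡ enum j
  same-pair⇒same-value i j eq = trans (sym (value-mn i)) (trans (cong (λ z → value (proj₁ z) (proj₂ z)) eq) (value-mn j))

  pairs : ℕ → List (ℕ × ℕ)
  pairs = applyDownFrom pair

  pairs-unique : ∀ j → Unique (pairs j)
  pairs-unique j = applyDownFrom⁺₁ pair j (λ {i} {i′} i′<i _ eq → ℕP.<-irrefl (sym (same-pair⇒same-value i i′ eq)) (enum-mono i′<i))

  box : ℕ → List (ℕ × ℕ)
  box M = cartesianProduct (range M) (range M)

  box-unique : ∀ M → Unique (box M)
  box-unique M = cartesianProduct⁺ (range-unique M) (range-unique M)

  -- The first j pairs lie in the square up to enum j, since each exponent is below its value.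
  pairs⊆box : ∀ j {z} → z ∈ pairs j → z ∈ box (enum j)
  pairs⊆box j z∈ with ∈-applyDownFrom⁻ pair z∈
  ... | i , i<j , refl = ∈-cartesianProduct⁺ (∈-range⁺ (m≥2 i) (below (x<value (m i) (n i))))
                                             (∈-range⁺ (n≥2 i) (below (y<value (m i) (n i))))
    where
    below : ∀ {e} → e ℕ.< value (m i) (n i) → e ℕ.< 2 ℕ.+ enum j
    below e<v = ℕP.<-trans (subst (_ ℕ.<_) (value-mn i) e<v) (ℕP.<-≤-trans (enum-mono i<j) (ℕP.m≤n+m _ 2))

  box⊆pairs : ∀ M {z} → z ∈ box M → z ∈ pairs (suc (value (suc M) (suc M)))
  box⊆pairs M {x , y} z∈ with ∈-cartesianProduct⁻ (range M) (range M) z∈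
  ... | x∈ , y∈ with ∈-range⁻ x∈ | ∈-range⁻ y∈
  ... | 2≤x , x<2+M | 2≤y , y<2+M with pair-index x y 2≤x 2≤y
  ... | i , (refl , refl) , i≤value =
    ∈-applyDownFrom⁺ pair (s≤s (ℕP.≤-trans i≤value (value-mono (ℕP.≤-pred x<2+M) (ℕP.≤-pred y<2+M))))

  module Base3 = ArithmeticoGeometric 2
  module Base5 = ArithmeticoGeometric 4

  quad : Fin 4 → ℕ → ℚ
  quad zero                   i = recip (value (m i) (n i))
  quad (suc zero)             i = frac (m i) (value (m i) (n i))
  quad (suc (suc zero))       i = frac (m i ℕ.* n i) (value (m i) (n i))
  quad (suc (suc (suc zero))) i = frac (n i) (value (m i) (n i))

  as : ℕ → ℚ
  as = blockSeries quad

  as-at : ∀ i r → as (4 ℕ.* i ℕ.+ suc (toℕ r)) ≡ quad r i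
  as-at i r = trans (cong as (ℕP.+-comm (4 ℕ.* i) (suc (toℕ r)))) (blocks-at quad i r)

  quad-pos : ∀ r i → 0ℚ < quad r i
  quad-pos zero i = subst (0ℚ <_) (sym (recip≡frac1 (value (m i) (n i))))
                      (frac-pos 1 (value (m i) (n i)) {{value≢0 (m i) (n i)}} (s≤s z≤n))
  quad-pos (suc zero) i = frac-pos (m i) (value (m i) (n i)) {{value≢0 (m i) (n i)}} (ℕP.<-trans (s≤s z≤n) (m≥2 i))
  quad-pos (suc (suc zero)) i = frac-pos (m i ℕ.* n i) (value (m i) (n i)) {{value≢0 (m i) (n i)}}
                                  (ℕP.*-mono-≤ (ℕP.<-trans (s≤s z≤n) (m≥2 i)) (ℕP.<-trans (s≤s z≤n) (n≥2 i)))
  quad-pos (suc (suc (suc zero))) i = frac-pos (n i) (value (m i) (n i)) {{value≢0 (m i) (n i)}} (ℕP.<-trans (s≤s z≤n) (n≥2 i))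

  as-pos : ∀ k → 1 ℕ.≤ k → 0ℚ < as k
  as-pos (suc k) _ = blocks-all (0ℚ <_) quad quad-pos k

  weight : ℕ × ℕ → ℚ
  weight (x , y) = Base3.term x * Base5.term y

  weight-nonNeg : ∀ z → 0ℚ ≤ weight z
  weight-nonNeg (x , y) = ℚP.nonNegative⁻¹ (weight (x , y))
    {{ℚP.nonNeg*nonNeg⇒nonNeg (Base3.term x) {{ℚ.nonNegative (ℚP.<⇒≤ (Base3.term-pos x))}}
                               (Base5.term y) {{ℚ.nonNegative (ℚP.<⇒≤ (Base5.term-pos y))}}}}

  block-weight : ∀ x y → ((recip (value x y) + frac x (value x y)) + frac (x ℕ.* y) (value x y)) + frac y (value x y)
                         ≡ weight (x , y)
  block-weight x y = begin
    ((recip V + frac x V) + frac (x ℕ.* y) V) + frac y V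
      ≡⟨ cong (λ t → ((t + frac x V) + frac (x ℕ.* y) V) + frac y V) (recip≡frac1 V) ⟩
    ((frac 1 V + frac x V) + frac (x ℕ.* y) V) + frac y V
      ≡⟨ cong (λ t → (t + frac (x ℕ.* y) V) + frac y V) (frac-+-common 1 x V) ⟩
    (frac (1 ℕ.+ x) V + frac (x ℕ.* y) V) + frac y V
      ≡⟨ cong (_+ frac y V) (frac-+-common (1 ℕ.+ x) (x ℕ.* y) V) ⟩
    frac (1 ℕ.+ x ℕ.+ x ℕ.* y) V + frac y V
      ≡⟨ frac-+-common (1 ℕ.+ x ℕ.+ x ℕ.* y) y V ⟩
    frac (1 ℕ.+ x ℕ.+ x ℕ.* y ℕ.+ y) V
      ≡⟨ cong (λ t → frac t V) (factor x y) ⟩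
    frac (suc x ℕ.* suc y) V
      ≡⟨ sym (frac-* (suc x) (3 ^ x) (suc y) (5 ^ y) {{ℕP.m^n≢0 3 x}} {{ℕP.m^n≢0 5 y}}) ⟩
    weight (x , y) ∎
    where
    open ≡-Reasoning
    V = value x y
    instance
      V≢0 : NonZero V
      V≢0 = value≢0 x y
    factor : ∀ x y → 1 ℕ.+ x ℕ.+ x ℕ.* y ℕ.+ y ≡ suc x ℕ.* suc y
    factor = solve-∀

  partialSum-pairs : ∀ j → partialSum as (4 ℕ.* j) ≡ sumL weight (pairs j)
  partialSum-pairs j = trans (partialSum-blocks quad j) (by-block j)
    where
    by-block : ∀ j → sumL (blockTotal quad) (downFrom j) ≡ sumL weight (pairs j)
    by-block zero    = refl
    by-block (suc j) = cong₂ _+_ (block-weight (m j) (n j)) (by-block j)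

  partialSum-mono-as : ∀ {K K′} → K ℕ.≤ K′ → partialSum as K ≤ partialSum as K′
  partialSum-mono-as = partialSum-mono as (λ k → ℚP.<⇒≤ (as-pos (suc k) (s≤s z≤n)))

  a : ℚ
  a = Base3.total * Base5.total

  box-sum : ∀ M → sumL weight (box M) ≡ Base3.partial M * Base5.partial M
  box-sum M = sumL-cartesianProduct Base3.term Base5.term (range M) (range M)

  -- Every partial sum is at most a: it is dominated by the sum over a square of pairs.
  partialSum≤a : ∀ K → partialSum as K ≤ a
  partialSum≤a K = begin
    partialSum as K                          ≤⟨ partialSum-mono-as (ℕP.m≤n*m K 4) ⟩
    partialSum as (4 ℕ.* K)                  ≡⟨ partialSum-pairs K ⟩
    sumL weight (pairs K)                    ≤⟨ sumL-⊆ weight weight-nonNeg (box B) (pairs-unique K) (pairs⊆box K) ⟩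
    sumL weight (box B)                      ≡⟨ box-sum B ⟩
    Base3.partial B * Base5.partial B        ≤⟨ *-mono-≤-nonNeg (Base3.partial-nonNeg B) (Base5.partial-nonNeg B)
                                                  (Base3.partial≤total B) (Base5.partial≤total B) ⟩
    a                                        ∎
    where
    open ℚP.≤-Reasoning
    B = enum K

  box≤partialSum : ∀ M K → 4 ℕ.* suc (value (suc M) (suc M)) ℕ.≤ K →
                   Base3.partial M * Base5.partial M ≤ partialSum as K
  box≤partialSum M K N≤K = begin
    Base3.partial M * Base5.partial M ≡⟨ sym (box-sum M) ⟩
    sumL weight (box M)               ≤⟨ sumL-⊆ weight weight-nonNeg (pairs N) (box-unique M) (box⊆pairs M) ⟩
    sumL weight (pairs N)             ≡⟨ sym (partialSum-pairs N) ⟩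
    partialSum as (4 ℕ.* N)           ≤⟨ partialSum-mono-as N≤K ⟩
    partialSum as K                   ∎
    where
    open ℚP.≤-Reasoning
    N = suc (value (suc M) (suc M))

  -- For M = horizon d the square's sum is within 1/(d + 1) of a; here the totals 7/12 and 13/80
  -- are checked to be at most 1 by computation.
  a<box+ : ∀ d → a < Base3.partial (horizon d) * Base5.partial (horizon d) + frac 1 (suc d)
  a<box+ d = begin-strict
    a                       ≡⟨ sym (cong₂ _*_ (Base3.partial+tail M) (Base5.partial+tail M)) ⟩
    (g + r) * (h + r′)      ≤⟨ product-truncation (Base3.partial-nonNeg M) (Base3.tail-nonNeg M) (Base5.partial-nonNeg M)
                                 (Base5.tail-nonNeg M) (subst (_≤ 1ℚ) (sym (Base3.partial+tail M)) total₃≤1)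
                                 (subst (_≤ 1ℚ) (sym (Base5.partial+tail M)) total₅≤1) ⟩
    g * h + (r + r′)        <⟨ ℚP.+-monoʳ-< (g * h) (ℚP.+-mono-< (Base3.tail-small d) (Base5.tail-small d)) ⟩
    g * h + (ε′ + ε′)       ≡⟨ cong (_+_ (g * h)) (halves d) ⟩
    g * h + frac 1 (suc d)  ∎
    where
    open ℚP.≤-Reasoning
    M = horizon d
    g = Base3.partial M
    h = Base5.partial M
    r = Base3.tail M
    r′ = Base5.tail M
    ε′ = frac 1 (2 ℕ.* suc d)
    total₃≤1 : Base3.total ≤ 1ℚ
    total₃≤1 = from-yes (Base3.total ℚ.≤? 1ℚ)
    total₅≤1 : Base5.total ≤ 1ℚ
    total₅≤1 = from-yes (Base5.total ℚ.≤? 1ℚ)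

  converges : ∀ ε → 0ℚ < ε → ∃ λ N → ∀ K → N ℕ.≤ K → ∣ partialSum as K - a ∣ < ε
  converges ε 0<ε with unit-fraction-below ε 0<ε
  ... | d , 1/[d+1]≤ε = 4 ℕ.* suc (value (suc M) (suc M)) , λ K N≤K →
    close-from-below (partialSum≤a K)
      (ℚP.<-≤-trans (a<box+ d) (ℚP.+-mono-≤ (box≤partialSum M K N≤K) 1/[d+1]≤ε))
    where
    M = horizon d

  value>1 : ∀ x y → 1 ℕ.< x → 1 ℕ.< value x y
  value>1 x y 1<x = ℕP.<-trans 1<x (x<value x y)

  pairs-onto : ∀ x y → 1 ℕ.< x → 1 ℕ.< y → ∃ λ i → m i ≡ x × n i ≡ y
  pairs-onto x y 1<x 1<y = proj₁ (pair-index x y 1<x 1<y) , proj₁ (proj₂ (pair-index x y 1<x 1<y))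

  values-increasing : ∀ i → value (m i) (n i) ℕ.< value (m (suc i)) (n (suc i))
  values-increasing i = subst₂ ℕ._<_ (sym (value-mn i)) (sym (value-mn (suc i))) (enum-step i)

  as-blocks : ∀ i → as (4 ℕ.* i ℕ.+ 1) ≡ recip (value (m i) (n i))
                  × as (4 ℕ.* i ℕ.+ 2) ≡ frac (m i) (value (m i) (n i))
                  × as (4 ℕ.* i ℕ.+ 3) ≡ frac (m i ℕ.* n i) (value (m i) (n i))
                  × as (4 ℕ.* i ℕ.+ 4) ≡ frac (n i) (value (m i) (n i))
  as-blocks i = as-at i zero , as-at i (suc zero) , as-at i (suc (suc zero)) , as-at i (suc (suc (suc zero)))

  0<a : 0ℚ < a
  0<a = from-yes (0ℚ ℚ.<? a)

  a<1 : a < 1ℚ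
  a<1 = from-yes (a ℚ.<? 1ℚ)


open Proof

open import Data.Nat using (ℕ; suc; _^_; _≤_; s≤s; z≤n)
open import Data.Nat as ℕ using ()
open import Data.Product using (Σ; ∃; _×_; _,_)
open import Data.Rational using (ℚ; _+_; _*_; _-_; _<_; ∣_∣; 0ℚ; 1ℚ)
open import Data.Rational as ℚ using ()
open import Data.Integer using (+_)
open import Relation.Binary.PropositionalEquality using (_≡_)

lemma2 : Σ ℕ λ p → Σ ℕ λ q → Σ (ℕ → ℕ) λ m → Σ (ℕ → ℕ) λ n → Σ ℚ λ a → Σ (ℕ → ℚ) λ as →
    (1 ℕ.< p) × (1 ℕ.< q)
    × (∀ i → 1 ℕ.< m i × 1 ℕ.< n i)
    × (0ℚ < a)
    × (∀ k → 1 ≤ k → 0ℚ < as k)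
    × (∀ x y → 1 ℕ.< x → 1 ℕ.< y → 1 ℕ.< p ^ x ℕ.* q ^ y)
    × (∀ x y x′ y′ → 1 ℕ.< x → 1 ℕ.< y → 1 ℕ.< x′ → 1 ℕ.< y′ →
         p ^ x ℕ.* q ^ y ≡ p ^ x′ ℕ.* q ^ y′ → x ≡ x′ × y ≡ y′)
    × (∀ x y → 1 ℕ.< x → 1 ℕ.< y → ∃ λ i → m i ≡ x × n i ≡ y)
    × (∀ i → p ^ m i ℕ.* q ^ n i ℕ.< p ^ m (suc i) ℕ.* q ^ n (suc i))
    × (∀ i → as (4 ℕ.* i ℕ.+ 1) ≡ recip (p ^ m i ℕ.* q ^ n i)
           × as (4 ℕ.* i ℕ.+ 2) ≡ ((+ (m i)) ℚ./ 1) * recip (p ^ m i ℕ.* q ^ n i)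
           × as (4 ℕ.* i ℕ.+ 3) ≡ ((+ (m i ℕ.* n i)) ℚ./ 1) * recip (p ^ m i ℕ.* q ^ n i)
           × as (4 ℕ.* i ℕ.+ 4) ≡ ((+ (n i)) ℚ./ 1) * recip (p ^ m i ℕ.* q ^ n i))
    × (∀ ε → 0ℚ < ε → ∃ λ N → ∀ K → N ≤ K → ∣ partialSum as K - a ∣ < ε)
    × (a < 1ℚ)
lemma2 = 3 , 5 , m , n , a , as
  , s≤s (s≤s z≤n) , s≤s (s≤s z≤n)
  , (λ i → m≥2 i , n≥2 i)
  , 0<a
  , as-pos
  , (λ x y 1<x _ → value>1 x y 1<x)
  , (λ x y x′ y′ _ _ _ _ → value-injective x y x′ y′)
  , pairs-onto
  , values-increasing
  , as-blocks
  , converges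
  , a<1
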